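{- Let $G$ be a finite simple graph and $k>0$ an integer, let $S$ be a global defensive $k$-alliance of $G$ of minimum cardinality, and suppose that the induced subgraph $G\langle S\rangle$ has a $1$-perfect code. If $H$ is a finite simple graph with more than one vertex, then the lexicographic product $G[H]$ has a global defensive $k$-alliance. Moreover, if $k\ge 2$, then $$\gamma^d_k(G[H])\leq n(H)\big(\gamma^d_k(G)-\gamma(G\langle S\rangle)\big)+\gamma(G\langle S\rangle),$$ where $n(H)=|V_H|$ and $\gamma$ denotes the domination number.
   Context: For a graph $G$ and $S\subseteq V_G$, $\bar S=V_G\setminus S$, $N_S(v)=\{u\in S: uv\in E_G\}$, and $G\langle S\rangle$ is the subgraph induced by $S$. A set $D$ is dominating if every vertex not in $D$ has a neighbor in $D$; $\gamma(G)$ is the minimum size of a dominating set. For an integer $k$, a nonempty set $S\subseteq V_G$ is a global defensive $k$-alliance of $G$ if $S$ is dominating and $|N_S(v)|\ge |N_{\bar S}(v)|+k$ for every $v\in S$; $\gamma^d_k(G)$ is the minimum cardinality of such a set ($\infty$ if none exists). A $1$-perfect code in a graph $F$ is a set $D\subseteq V_F$ such that the closed neighborhoods (balls of radius $1$) of the vertices of $D$ partition $V_F$. The lexicographic product $G[H]$ has vertex set $V_G\times V_H$, with $(g_1,h_1)$ adjacent to $(g_2,h_2)$ iff $g_1g_2\in E_G$, or $g_1=g_2$ and $h_1h_2\in E_H$. -}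

module Defs where

open import Data.Nat using (ℕ; _≤_)
open import Data.Integer as ℤ using (ℤ; +_)
open import Data.Bool using (Bool; true; false; _∨_; _∧_)
open import Data.Fin using (Fin; remQuot)
open import Data.Fin.Properties using () renaming (_≟_ to _≟ᶠ_)
open import Data.Fin.Subset using (Subset; _∈_; _∉_; _⊆_; ∁; _∩_; ∣_∣; Nonempty)
open import Data.Vec using (tabulate)
open import Data.Product using (Σ; ∃; _×_; _,_)
open import Data.Sum using (_⊎_)
open import Relation.Nullary.Decidable using (⌊_⌋)
open import Relation.Binary.PropositionalEquality using (_≡_)

record Graph : Set where
  field
    n   : ℕ
    adj : Fin n → Fin n → Bool
open Graph public

IsSimple : Graph → Set
IsSimple G = (∀ u v → adj G u v ≡ adj G v u) × (∀ v → adj G v v ≡ false)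

Nbhd : (G : Graph) → Fin (n G) → Subset (n G)
Nbhd G v = tabulate (adj G v)

degIn : (G : Graph) → Subset (n G) → Fin (n G) → ℕ
degIn G S v = ∣ S ∩ Nbhd G v ∣

Dominating : (G : Graph) → Subset (n G) → Set
Dominating G D = ∀ v → v ∉ D → ∃ λ u → u ∈ D × adj G v u ≡ true

IsGDA : (G : Graph) → ℤ → Subset (n G) → Set
IsGDA G k S = Nonempty S × Dominating G S
  × (∀ v → v ∈ S → + degIn G (∁ S) v ℤ.+ k ℤ.≤ + degIn G S v)

IsMinGDA : (G : Graph) → ℤ → Subset (n G) → Set
IsMinGDA G k S = IsGDA G k S × (∀ S′ → IsGDA G k S′ → ∣ S ∣ ≤ ∣ S′ ∣)

-- D is a dominating set of the induced subgraph G⟨S⟩ (vertices of G⟨S⟩ = members of S)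
InducedDominating : (G : Graph) → Subset (n G) → Subset (n G) → Set
InducedDominating G S D = D ⊆ S
  × (∀ v → v ∈ S → v ∉ D → ∃ λ u → u ∈ D × adj G v u ≡ true)

IsDomNumInduced : (G : Graph) → Subset (n G) → ℕ → Set
IsDomNumInduced G S g = (∃ λ D → InducedDominating G S D × ∣ D ∣ ≡ g)
  × (∀ D → InducedDominating G S D → g ≤ ∣ D ∣)

InClosedNbhd : (G : Graph) → Fin (n G) → Fin (n G) → Set
InClosedNbhd G v u = u ≡ v ⊎ adj G v u ≡ true

IsPerfectCodeInduced : (G : Graph) → Subset (n G) → Subset (n G) → Set
IsPerfectCodeInduced G S D = D ⊆ S
  × (∀ v → v ∈ S → ∃ λ u → (u ∈ D × InClosedNbhd G v u)
       × (∀ w → w ∈ D → InClosedNbhd G v w → w ≡ u))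

-- lexicographic product G[H], vertex (g,h) encoded via remQuot : Fin (n G * n H) → Fin (n G) × Fin (n H)
lexAdj : (G H : Graph) → (Fin (n G) × Fin (n H)) → (Fin (n G) × Fin (n H)) → Bool
lexAdj G H (g₁ , h₁) (g₂ , h₂) = adj G g₁ g₂ ∨ (⌊ g₁ ≟ᶠ g₂ ⌋ ∧ adj H h₁ h₂)

lex : Graph → Graph → Graph
lex G H = record
  { n   = n G Data.Nat.* n H
  ; adj = λ x y → lexAdj G H (remQuot (n H) x) (remQuot (n H) y)
  }

-- Fix a vertex h₀ of H and a set D ⊆ S, and blow S up to
-- T = (S ∖ D) × V_H ∪ D × {h₀} in G[H].  A vertex (s, h) sees the whole fibre
-- {u} × V_H for every neighbour u of s, and otherwise only H-neighbours in its
-- own fibre; so its degrees into T and ∁T are n(H) times the degrees of s into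
-- S and ∁S, corrected by n(H) − 1 for each neighbour of s in D (and for s itself
-- when s ∈ D).  The defence inequality of S therefore scales up to T as soon as
-- D is independent, every vertex of S has at most m neighbours in D, and 2m ≤ k.
-- D = ∅ gives the first claim.  A 1-perfect code D of G⟨S⟩ is independent, and
-- every vertex of S has at most one neighbour in it (m = 1); moreover
-- |T| = n(H)(|S| − |D|) + |D|, which is at most n(H)(|S| − γ) + γ because D
-- dominates G⟨S⟩.

module Submission where

open import Defs
open import Data.Nat using (ℕ; _≤_; _<_; _*_; _+_; _∸_)
open import Data.Integer as ℤ using (ℤ; +_)
open import Data.Fin.Subset using (Subset; ∣_∣)
open import Data.Product using (∃; _×_)

open import Data.Bool using (Bool; true; false; _∧_; _∨_; not)
open import Data.Bool.Properties using (∨-identityʳ)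
open import Data.Fin using (Fin; zero; suc; fromℕ<; _↑ˡ_; _↑ʳ_; combine; remQuot)
open import Data.Fin.Properties using (_≟_; remQuot-combine; combine-remQuot)
open import Data.Fin.Subset using (_∈_; _∉_; _⊆_; _∩_; ∁; ⊤; ⊥; ⁅_⁆; Nonempty; Empty)
open import Data.Fin.Subset.Properties
  using ( _∈?_; nonempty?; Empty-unique; x∈p∩q⁻; x∈⁅x⁆; ∈⊤; ∉⊥; x∈p⇒x∉∁p; x∉p⇒x∈∁p; ⊥⊆
        ; ∣⊥∣≡0; ∣⊤∣≡n; ∣⁅x⁆∣≡1; ∣∁p∣≡n∸∣p∣; ∣p∩q∣≤∣p∣; p⊆q⇒∣p∣≤∣q∣)
open import Data.Integer.Properties using (drop‿+≤+)
open import Data.Nat using (zero; suc; pred; z≤n; s≤s)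
open import Data.Nat.Properties
  using ( +-*-semiring; +-comm; +-assoc; +-identityʳ; *-zeroʳ; *-identityʳ; *-assoc
        ; *-distribˡ-+; *-distribʳ-+; n∸n≡0; m∸n+n≡m; n>0⇒n≢0
        ; ≤-trans; ≤-reflexive; <-trans; m≤m+n; m≤n+m; +-mono-≤; +-monoˡ-≤; +-monoʳ-≤; *-monoʳ-≤
        ; +-cancelʳ-≤; module ≤-Reasoning)
open import Data.Nat.Tactic.RingSolver using (solve-∀)
open import Data.Product using (_,_; proj₁; proj₂; uncurry)
open import Data.Sum using (inj₁; inj₂)
open import Data.Vec using ([]; _∷_; lookup; tabulate)
open import Data.Vec.Properties
  using (lookup∘tabulate; lookup-zipWith; lookup-map; tabulate-∘; tabulate-cong; []=⇒lookup; lookup⇒[]=)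
open import Function using (_∘_)
open import Relation.Nullary using (yes; no; contradiction)
open import Relation.Nullary.Decidable using (does; ⌊_⌋)
open import Relation.Binary.PropositionalEquality
open import Algebra.Properties.Semiring.Sum +-*-semiring
  using (sum-syntax; sum-cong-≗; sum-replicate-zero; ∑-distrib-+; *-distribˡ-sum; *-distribʳ-sum)

𝟙 : Bool → ℕ
𝟙 true  = 1
𝟙 false = 0

χ : ∀ {m} → Subset m → Fin m → ℕ
χ p i = 𝟙 (lookup p i)

χ-∈ : ∀ {m} {p : Subset m} {i} → i ∈ p → χ p i ≡ 1
χ-∈ i∈p = cong 𝟙 ([]=⇒lookup i∈p)

χ-∉ : ∀ {m} {p : Subset m} {i} → i ∉ p → χ p i ≡ 0
χ-∉ {p = p} {i} i∉p with lookup p i in eq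
... | true  = contradiction (lookup⇒[]= i p eq) i∉p
... | false = refl

χ-∩ : ∀ {m} (p q : Subset m) i → χ (p ∩ q) i ≡ χ p i * χ q i
χ-∩ p q i rewrite lookup-zipWith _∧_ i p q with lookup p i | lookup q i
... | true  | true  = refl
... | true  | false = refl
... | false | _     = refl

∣p∣≡∑χ : ∀ {m} (p : Subset m) → ∣ p ∣ ≡ ∑[ i < m ] χ p i
∣p∣≡∑χ []          = refl
∣p∣≡∑χ (true ∷ p)  = cong suc (∣p∣≡∑χ p)
∣p∣≡∑χ (false ∷ p) = ∣p∣≡∑χ p

∣p∣>0⇒Nonempty : ∀ {m} (p : Subset m) → 0 < ∣ p ∣ → Nonempty p
∣p∣>0⇒Nonempty {m} p ∣p∣>0 with nonempty? p
... | yes ne = ne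
... | no ¬ne = contradiction (trans (cong ∣_∣ (Empty-unique ¬ne)) (∣⊥∣≡0 m)) (n>0⇒n≢0 ∣p∣>0)

∑-↑ : ∀ a {b} (f : Fin (a + b) → ℕ) →
      ∑[ i < a + b ] f i ≡ ∑[ i < a ] f (i ↑ˡ b) + ∑[ j < b ] f (a ↑ʳ j)
∑-↑ zero    f = refl
∑-↑ (suc a) f = trans (cong (_+_ (f zero)) (∑-↑ a (f ∘ suc))) (sym (+-assoc (f zero) _ _))

∑-combine : ∀ m {n} (f : Fin (m * n) → ℕ) →
            ∑[ x < m * n ] f x ≡ ∑[ u < m ] ∑[ j < n ] f (combine u j)
∑-combine zero        f = refl
∑-combine (suc m) {n} f =
  trans (∑-↑ n f) (cong (_+_ (∑[ j < n ] f (combine {suc m} zero j))) (∑-combine m (f ∘ (n ↑ʳ_))))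

-- Stated with does rather than ⌊_⌋: does (suc s ≟ suc u) reduces to does (s ≟ u), ⌊_⌋ does not.
∑-δ : ∀ {m} (s : Fin m) (f : Fin m → ℕ) → ∑[ u < m ] (𝟙 (does (s ≟ u)) * f u) ≡ f s
∑-δ {suc m} zero    f =
  trans (cong₂ _+_ (+-identityʳ (f zero)) (sum-replicate-zero m)) (+-identityʳ (f zero))
∑-δ {suc m} (suc s) f = ∑-δ s (f ∘ suc)

combine-elim : ∀ {m n} (P : Fin (m * n) → Set) → (∀ u j → P (combine u j)) → ∀ x → P x
combine-elim {m} {n} P P-combine x =
  subst P (combine-remQuot {m} n x) (uncurry P-combine (remQuot {m} n x))

∣∁⁅h⁆∣≡pred : ∀ {N} (h : Fin N) → ∣ ∁ ⁅ h ⁆ ∣ ≡ pred N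
∣∁⁅h⁆∣≡pred {suc N} h = trans (∣∁p∣≡n∸∣p∣ ⁅ h ⁆) (cong (suc N ∸_) (∣⁅x⁆∣≡1 h))

∣⁅h⁆∣+pred≡ : ∀ {N} (h : Fin N) → ∣ ⁅ h ⁆ ∣ + pred N ≡ N
∣⁅h⁆∣+pred≡ {suc N} h = cong (_+ N) (∣⁅x⁆∣≡1 h)

∣∁⊤∣≡0 : ∀ N → ∣ ∁ (⊤ {N}) ∣ ≡ 0
∣∁⊤∣≡0 N = trans (∣∁p∣≡n∸∣p∣ (⊤ {N})) (trans (cong (N ∸_) (∣⊤∣≡n N)) (n∸n≡0 N))

∣∁⊥∣≡n : ∀ N → ∣ ∁ (⊥ {N}) ∣ ≡ N
∣∁⊥∣≡n N = trans (∣∁p∣≡n∸∣p∣ (⊥ {N})) (cong (N ∸_) (∣⊥∣≡0 N))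

scaled-defence : ∀ {N c d k o i E F} → c + k ≤ d → o ≤ N * c + E → N * d ≤ i + F →
                 E + F + k ≤ N * k → o + k ≤ i
scaled-defence {N} {c} {d} {k} {o} {i} {E} {F} c+k≤d o≤ Nd≤ budget = +-cancelʳ-≤ (N * k) (o + k) i (begin
  o + k + N * k          ≤⟨ +-monoˡ-≤ (N * k) (+-monoˡ-≤ k o≤) ⟩
  N * c + E + k + N * k  ≡⟨ regroup N c E k ⟩
  N * (c + k) + (E + k)  ≤⟨ +-monoˡ-≤ (E + k) (*-monoʳ-≤ N c+k≤d) ⟩
  N * d + (E + k)        ≤⟨ +-monoˡ-≤ (E + k) Nd≤ ⟩
  i + F + (E + k)        ≡⟨ regroup′ i F E k ⟩
  i + (E + F + k)        ≤⟨ +-monoʳ-≤ i budget ⟩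
  i + N * k              ∎)
  where
  open ≤-Reasoning
  regroup : ∀ N c E k → N * c + E + k + N * k ≡ N * (c + k) + (E + k)
  regroup = solve-∀
  regroup′ : ∀ i F E k → i + F + (E + k) ≡ i + (E + F + k)
  regroup′ = solve-∀

-- In the next two lemmas the Fin N argument only witnesses 0 < N, i.e. N = suc (pred N).
scaled-budget : ∀ {N a b k} → Fin N → a + b ≤ k → pred N * a + pred N * b + k ≤ N * k
scaled-budget {suc X} {a} {b} {k} _ a+b≤k = begin
  X * a + X * b + k  ≡⟨ cong (_+ k) (*-distribˡ-+ X a b) ⟨
  X * (a + b) + k    ≤⟨ +-monoˡ-≤ k (*-monoʳ-≤ X a+b≤k) ⟩
  X * k + k          ≡⟨ +-comm (X * k) k ⟩
  suc X * k          ∎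
  where open ≤-Reasoning

scaled-size : ∀ {N t d s g} → Fin N → t + pred N * d ≡ N * s → g ≤ d → d ≤ s → t ≤ N * (s ∸ g) + g
scaled-size {suc X} {t} {d} {s} {g} _ eq g≤d d≤s = +-cancelʳ-≤ (X * g) t (suc X * (s ∸ g) + g) (begin
  t + X * g                    ≤⟨ +-monoʳ-≤ t (*-monoʳ-≤ X g≤d) ⟩
  t + X * d                    ≡⟨ eq ⟩
  suc X * s                    ≡⟨ cong (suc X *_) (m∸n+n≡m (≤-trans g≤d d≤s)) ⟨
  suc X * (s ∸ g + g)          ≡⟨ regroup X (s ∸ g) g ⟩
  suc X * (s ∸ g) + g + X * g  ∎)
  where
  open ≤-Reasoning
  regroup : ∀ X r g → suc X * (r + g) ≡ suc X * r + g + X * g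
  regroup = solve-∀

Loopless : Graph → Set
Loopless G = ∀ v → adj G v v ≡ false

Independent : (G : Graph) → Subset (n G) → Set
Independent G D = ∀ {u v} → u ∈ D → v ∈ D → adj G u v ≡ false

weightedDeg : (G : Graph) → (Fin (n G) → ℕ) → Fin (n G) → ℕ
weightedDeg G w v = ∑[ u < n G ] (w u * 𝟙 (adj G v u))

degIn≡weightedDeg : ∀ G (A : Subset (n G)) v → degIn G A v ≡ weightedDeg G (χ A) v
degIn≡weightedDeg G A v = trans (∣p∣≡∑χ (A ∩ Nbhd G v)) (sum-cong-≗ λ u →
  trans (χ-∩ A (Nbhd G v) u) (cong (λ b → χ A u * 𝟙 b) (lookup∘tabulate (adj G v) u)))

weightedDeg-+ : ∀ G (w w′ : Fin (n G) → ℕ) v →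
                weightedDeg G (λ u → w u + w′ u) v ≡ weightedDeg G w v + weightedDeg G w′ v
weightedDeg-+ G w w′ v = trans (sum-cong-≗ λ u → *-distribʳ-+ (𝟙 (adj G v u)) (w u) (w′ u))
  (∑-distrib-+ (λ u → w u * 𝟙 (adj G v u)) (λ u → w′ u * 𝟙 (adj G v u)))

weightedDeg-* : ∀ G c (w : Fin (n G) → ℕ) v → weightedDeg G (λ u → c * w u) v ≡ c * weightedDeg G w v
weightedDeg-* G c w v = trans (sum-cong-≗ λ u → *-assoc c (w u) (𝟙 (adj G v u)))
  (sym (*-distribˡ-sum c (λ u → w u * 𝟙 (adj G v u))))

weightedDeg-cong : ∀ G {w w′ : Fin (n G) → ℕ} → (∀ u → w u ≡ w′ u) →
                   ∀ v → weightedDeg G w v ≡ weightedDeg G w′ v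
weightedDeg-cong G w≗w′ v = sum-cong-≗ λ u → cong (_* 𝟙 (adj G v u)) (w≗w′ u)

weightedDeg-χ : ∀ G c (A : Subset (n G)) v → weightedDeg G (λ u → c * χ A u) v ≡ c * degIn G A v
weightedDeg-χ G c A v = trans (weightedDeg-* G c (χ A) v) (cong (c *_) (sym (degIn≡weightedDeg G A v)))

∈Nbhd⁻ : ∀ G {u v} → u ∈ Nbhd G v → adj G v u ≡ true
∈Nbhd⁻ G {u} {v} u∈N = trans (sym (lookup∘tabulate (adj G v) u)) ([]=⇒lookup u∈N)

degIn>0⇒neighbour : ∀ G (A : Subset (n G)) v → 0 < degIn G A v → ∃ λ u → u ∈ A × adj G v u ≡ true
degIn>0⇒neighbour G A v deg>0 with ∣p∣>0⇒Nonempty (A ∩ Nbhd G v) deg>0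
... | u , u∈A∩N with x∈p∩q⁻ A (Nbhd G v) u∈A∩N
...   | u∈A , u∈N = u , u∈A , ∈Nbhd⁻ G u∈N

Independent⇒degIn≡0 : ∀ G {D} → Independent G D → ∀ {v} → v ∈ D → degIn G D v ≡ 0
Independent⇒degIn≡0 G {D} indep {v} v∈D =
  trans (cong ∣_∣ (Empty-unique noNeighbour)) (∣⊥∣≡0 (n G))
  where
  noNeighbour : Empty (D ∩ Nbhd G v)
  noNeighbour (u , u∈D∩N) with x∈p∩q⁻ D (Nbhd G v) u∈D∩N
  ... | u∈D , u∈N = contradiction (trans (sym (∈Nbhd⁻ G u∈N)) (indep v∈D u∈D)) λ ()

⊥-independent : ∀ G → Independent G ⊥
⊥-independent G u∈⊥ _ = contradiction u∈⊥ ∉⊥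

degIn-⊥ : ∀ G v → degIn G ⊥ v ≤ 0
degIn-⊥ G v = ≤-trans (∣p∩q∣≤∣p∣ ⊥ (Nbhd G v)) (≤-reflexive (∣⊥∣≡0 (n G)))

module _ (G : Graph) {S D : Subset (n G)} (code : IsPerfectCodeInduced G S D) where

  perfectCode-independent : Loopless G → Independent G D
  perfectCode-independent loopless {u} {v} u∈D v∈D with adj G u v in uv
  ... | false = refl
  ... | true with proj₂ code u (proj₁ code u∈D)
  ...   | c , _ , unique with trans (unique v v∈D (inj₂ uv)) (sym (unique u u∈D (inj₁ refl)))
  ...     | refl = contradiction (trans (sym uv) (loopless u)) λ ()

  perfectCode-packing : ∀ s → s ∈ S → degIn G D s ≤ 1
  perfectCode-packing s s∈S with proj₂ code s s∈S
  ... | c , _ , unique = ≤-trans (p⊆q⇒∣p∣≤∣q∣ D∩N⊆⁅c⁆) (≤-reflexive (∣⁅x⁆∣≡1 c))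
    where
    D∩N⊆⁅c⁆ : D ∩ Nbhd G s ⊆ ⁅ c ⁆
    D∩N⊆⁅c⁆ w∈D∩N with x∈p∩q⁻ D (Nbhd G s) w∈D∩N
    ... | w∈D , w∈N = subst (_∈ ⁅ c ⁆) (sym (unique _ w∈D (inj₂ (∈Nbhd⁻ G w∈N)))) (x∈⁅x⁆ c)

  perfectCode-dominating : InducedDominating G S D
  perfectCode-dominating = proj₁ code , dominated
    where
    dominated : ∀ v → v ∈ S → v ∉ D → ∃ λ u → u ∈ D × adj G v u ≡ true
    dominated v v∈S v∉D with proj₂ code v v∈S
    ... | c , (c∈D , inj₁ refl) , _ = contradiction c∈D v∉D
    ... | c , (c∈D , inj₂ vc)  , _ = c , c∈D , vc

module _ (G H : Graph) where

  fibred : (Fin (n G) → Subset (n H)) → Subset (n (lex G H))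
  fibred Q = tabulate (uncurry (λ u j → lookup (Q u) j) ∘ remQuot {n G} (n H))

  lookup-fibred : ∀ Q u j → lookup (fibred Q) (combine u j) ≡ lookup (Q u) j
  lookup-fibred Q u j = trans (lookup∘tabulate _ (combine u j))
    (cong (uncurry (λ u j → lookup (Q u) j)) (remQuot-combine {n G} u j))

  ∈-fibred⁺ : ∀ Q {u j} → j ∈ Q u → combine u j ∈ fibred Q
  ∈-fibred⁺ Q {u} {j} j∈Qu =
    lookup⇒[]= (combine u j) (fibred Q) (trans (lookup-fibred Q u j) ([]=⇒lookup j∈Qu))

  ∈-fibred⁻ : ∀ Q {u j} → combine u j ∈ fibred Q → j ∈ Q u
  ∈-fibred⁻ Q {u} {j} uj∈T =
    lookup⇒[]= j (Q u) (trans (sym (lookup-fibred Q u j)) ([]=⇒lookup uj∈T))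

  ∁-fibred : ∀ Q → ∁ (fibred Q) ≡ fibred (∁ ∘ Q)
  ∁-fibred Q = trans (sym (tabulate-∘ not _)) (tabulate-cong λ x →
    let (u , j) = remQuot {n G} (n H) x in sym (lookup-map j not (Q u)))

  ∣fibred∣ : ∀ Q → ∣ fibred Q ∣ ≡ ∑[ u < n G ] ∣ Q u ∣
  ∣fibred∣ Q = trans (∣p∣≡∑χ (fibred Q)) (trans (∑-combine (n G) (χ (fibred Q)))
    (sum-cong-≗ λ u → trans (sum-cong-≗ λ j → cong 𝟙 (lookup-fibred Q u j)) (sym (∣p∣≡∑χ (Q u)))))

  adj-lex : ∀ s h u j → adj (lex G H) (combine s h) (combine u j) ≡ lexAdj G H (s , h) (u , j)
  adj-lex s h u j = cong₂ (lexAdj G H) (remQuot-combine {n G} s h) (remQuot-combine {n G} u j)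

  adj-lex-lift : ∀ {s u} h j → adj G s u ≡ true → adj (lex G H) (combine s h) (combine u j) ≡ true
  adj-lex-lift {s} {u} h j su = trans (adj-lex s h u j) (cong (_∨ (⌊ s ≟ u ⌋ ∧ adj H h j)) su)

  𝟙-lexAdj-split : Loopless G → ∀ q s h u j →
                 q * 𝟙 (adj G s u ∨ (⌊ s ≟ u ⌋ ∧ adj H h j))
                   ≡ q * 𝟙 (adj G s u) + 𝟙 (does (s ≟ u)) * (q * 𝟙 (adj H h j))
  𝟙-lexAdj-split loopless q s h u j with s ≟ u
  ... | yes refl rewrite loopless s = sym (cong₂ _+_ (*-zeroʳ q) (+-identityʳ _))
  ... | no _ = trans (cong (λ b → q * 𝟙 b) (∨-identityʳ (adj G s u))) (sym (+-identityʳ _))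

  degIn-fibred : Loopless G → ∀ Q s h →
                 degIn (lex G H) (fibred Q) (combine s h) ≡ weightedDeg G (∣_∣ ∘ Q) s + degIn H (Q s) h
  degIn-fibred loopless Q s h = begin
    degIn (lex G H) (fibred Q) x
      ≡⟨ degIn≡weightedDeg (lex G H) (fibred Q) x ⟩
    ∑[ y < n G * n H ] (χ (fibred Q) y * 𝟙 (adj (lex G H) x y))
      ≡⟨ ∑-combine (n G) (λ y → χ (fibred Q) y * 𝟙 (adj (lex G H) x y)) ⟩
    ∑[ u < n G ] ∑[ j < n H ] (χ (fibred Q) (combine u j) * 𝟙 (adj (lex G H) x (combine u j)))
      ≡⟨ sum-cong-≗ (λ u → sum-cong-≗ λ j →
           cong₂ (λ b c → 𝟙 b * 𝟙 c) (lookup-fibred Q u j) (adj-lex s h u j)) ⟩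
    ∑[ u < n G ] ∑[ j < n H ] (χ (Q u) j * 𝟙 (lexAdj G H (s , h) (u , j)))
      ≡⟨ sum-cong-≗ (λ u → sum-cong-≗ λ j → 𝟙-lexAdj-split loopless (χ (Q u) j) s h u j) ⟩
    ∑[ u < n G ] ∑[ j < n H ] (χ (Q u) j * 𝟙 (adj G s u) + 𝟙 (does (s ≟ u)) * (χ (Q u) j * 𝟙 (adj H h j)))
      ≡⟨ sum-cong-≗ fibreSum ⟩
    ∑[ u < n G ] (∣ Q u ∣ * 𝟙 (adj G s u) + 𝟙 (does (s ≟ u)) * degIn H (Q u) h)
      ≡⟨ ∑-distrib-+ (λ u → ∣ Q u ∣ * 𝟙 (adj G s u)) (λ u → 𝟙 (does (s ≟ u)) * degIn H (Q u) h) ⟩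
    weightedDeg G (∣_∣ ∘ Q) s + ∑[ u < n G ] (𝟙 (does (s ≟ u)) * degIn H (Q u) h)
      ≡⟨ cong (_+_ (weightedDeg G (∣_∣ ∘ Q) s)) (∑-δ s (λ u → degIn H (Q u) h)) ⟩
    weightedDeg G (∣_∣ ∘ Q) s + degIn H (Q s) h ∎
    where
    open ≡-Reasoning
    x : Fin (n (lex G H))
    x = combine s h
    fibreSum : ∀ u → ∑[ j < n H ] (χ (Q u) j * 𝟙 (adj G s u) + 𝟙 (does (s ≟ u)) * (χ (Q u) j * 𝟙 (adj H h j)))
                     ≡ ∣ Q u ∣ * 𝟙 (adj G s u) + 𝟙 (does (s ≟ u)) * degIn H (Q u) h
    fibreSum u = trans (∑-distrib-+ (λ j → χ (Q u) j * a) (λ j → e * (χ (Q u) j * 𝟙 (adj H h j))))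
      (cong₂ _+_ (trans (sym (*-distribʳ-sum a (χ (Q u)))) (cong (_* a) (sym (∣p∣≡∑χ (Q u)))))
                 (trans (sym (*-distribˡ-sum e (λ j → χ (Q u) j * 𝟙 (adj H h j))))
                        (cong (e *_) (sym (degIn≡weightedDeg H (Q u) h)))))
      where
      a e : ℕ
      a = 𝟙 (adj G s u)
      e = 𝟙 (does (s ≟ u))

module _ (G H : Graph) (S D : Subset (n G)) (h₀ : Fin (n H)) where

  blowUpFibre : Fin (n G) → Subset (n H)
  blowUpFibre u with u ∈? D | u ∈? S
  ... | yes _ | _     = ⁅ h₀ ⁆
  ... | no _  | yes _ = ⊤
  ... | no _  | no _  = ⊥

  blowUp : Subset (n (lex G H))
  blowUp = fibred G H blowUpFibre

module _ (G H : Graph) {S D : Subset (n G)} (h₀ : Fin (n H)) where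

  private
    Q : Fin (n G) → Subset (n H)
    Q = blowUpFibre G H S D h₀

  h₀∈blowUp : ∀ {u} → u ∈ S → combine u h₀ ∈ blowUp G H S D h₀
  h₀∈blowUp {u} u∈S = ∈-fibred⁺ G H Q h₀∈Qu
    where
    h₀∈Qu : h₀ ∈ Q u
    h₀∈Qu with u ∈? D | u ∈? S
    ... | yes _ | _      = x∈⁅x⁆ h₀
    ... | no _  | yes _  = ∈⊤
    ... | no _  | no u∉S = contradiction u∈S u∉S

  ∈blowUp-full : ∀ {u} h → u ∈ S → u ∉ D → combine u h ∈ blowUp G H S D h₀
  ∈blowUp-full {u} h u∈S u∉D = ∈-fibred⁺ G H Q h∈Qu
    where
    h∈Qu : h ∈ Q u
    h∈Qu with u ∈? D | u ∈? S
    ... | yes u∈D | _      = contradiction u∈D u∉D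
    ... | no _    | yes _  = ∈⊤
    ... | no _    | no u∉S = contradiction u∈S u∉S

module _ (G H : Graph) {S D : Subset (n G)} (h₀ : Fin (n H)) (D⊆S : D ⊆ S) where

  private
    Q : Fin (n G) → Subset (n H)
    Q = blowUpFibre G H S D h₀
    N X : ℕ
    N = n H
    X = pred (n H)

  blowUp⇒∈ : ∀ {u h} → combine u h ∈ blowUp G H S D h₀ → u ∈ S
  blowUp⇒∈ {u} uh∈T = fibre (∈-fibred⁻ G H Q uh∈T)
    where
    fibre : ∀ {h} → h ∈ Q u → u ∈ S
    fibre h∈Qu with u ∈? D | u ∈? S
    ... | yes u∈D | _       = D⊆S u∈D
    ... | no _    | yes u∈S = u∈S
    ... | no _    | no _    = contradiction h∈Qu ∉⊥

  ∣blowUpFibre∣ : ∀ u → ∣ Q u ∣ + X * χ D u ≡ N * χ S u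
  ∣blowUpFibre∣ u with u ∈? D | u ∈? S
  ... | yes u∈D | _ rewrite χ-∈ u∈D | χ-∈ (D⊆S u∈D) =
    trans (cong (_+_ ∣ ⁅ h₀ ⁆ ∣) (*-identityʳ X)) (trans (∣⁅h⁆∣+pred≡ h₀) (sym (*-identityʳ N)))
  ... | no u∉D | yes u∈S rewrite χ-∉ u∉D | χ-∈ u∈S =
    trans (cong₂ _+_ (∣⊤∣≡n N) (*-zeroʳ X)) (trans (+-identityʳ N) (sym (*-identityʳ N)))
  ... | no u∉D | no u∉S rewrite χ-∉ u∉D | χ-∉ u∉S =
    trans (cong₂ _+_ (∣⊥∣≡0 N) (*-zeroʳ X)) (sym (*-zeroʳ N))

  ∣∁blowUpFibre∣ : ∀ u → ∣ ∁ (Q u) ∣ ≡ N * χ (∁ S) u + X * χ D u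
  ∣∁blowUpFibre∣ u with u ∈? D | u ∈? S
  ... | yes u∈D | _ rewrite χ-∈ u∈D | χ-∉ (x∈p⇒x∉∁p (D⊆S u∈D)) =
    trans (∣∁⁅h⁆∣≡pred h₀) (sym (cong₂ _+_ (*-zeroʳ N) (*-identityʳ X)))
  ... | no u∉D | yes u∈S rewrite χ-∉ u∉D | χ-∉ (x∈p⇒x∉∁p u∈S) =
    trans (∣∁⊤∣≡0 N) (sym (cong₂ _+_ (*-zeroʳ N) (*-zeroʳ X)))
  ... | no u∉D | no u∉S rewrite χ-∉ u∉D | χ-∈ (x∉p⇒x∈∁p u∉S) =
    trans (∣∁⊥∣≡n N) (sym (trans (cong₂ _+_ (*-identityʳ N) (*-zeroʳ X)) (+-identityʳ N)))

  ∣blowUp∣ : ∣ blowUp G H S D h₀ ∣ + X * ∣ D ∣ ≡ N * ∣ S ∣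
  ∣blowUp∣ = begin
    ∣ blowUp G H S D h₀ ∣ + X * ∣ D ∣
      ≡⟨ cong₂ _+_ (∣fibred∣ G H Q) (cong (X *_) (∣p∣≡∑χ D)) ⟩
    ∑[ u < n G ] ∣ Q u ∣ + X * ∑[ u < n G ] χ D u
      ≡⟨ cong (_+_ (∑[ u < n G ] ∣ Q u ∣)) (*-distribˡ-sum X (χ D)) ⟩
    ∑[ u < n G ] ∣ Q u ∣ + ∑[ u < n G ] (X * χ D u)
      ≡⟨ ∑-distrib-+ (∣_∣ ∘ Q) (λ u → X * χ D u) ⟨
    ∑[ u < n G ] (∣ Q u ∣ + X * χ D u)
      ≡⟨ sum-cong-≗ ∣blowUpFibre∣ ⟩
    ∑[ u < n G ] (N * χ S u)
      ≡⟨ *-distribˡ-sum N (χ S) ⟨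
    N * ∑[ u < n G ] χ S u
      ≡⟨ cong (N *_) (∣p∣≡∑χ S) ⟨
    N * ∣ S ∣ ∎
    where open ≡-Reasoning

  blowUp-size : ∀ {g} → g ≤ ∣ D ∣ → ∣ blowUp G H S D h₀ ∣ ≤ N * (∣ S ∣ ∸ g) + g
  blowUp-size g≤∣D∣ = scaled-size h₀ ∣blowUp∣ g≤∣D∣ (p⊆q⇒∣p∣≤∣q∣ D⊆S)

module _ (G H : Graph) (loopless : Loopless G) {S D : Subset (n G)} (h₀ : Fin (n H)) (D⊆S : D ⊆ S) where

  private
    T : Subset (n (lex G H))
    T = blowUp G H S D h₀
    Q : Fin (n G) → Subset (n H)
    Q = blowUpFibre G H S D h₀
    N X : ℕ
    N = n H
    X = pred (n H)

  blowUp-inDegree : ∀ s h → N * degIn G S s ≤ degIn (lex G H) T (combine s h) + X * degIn G D s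
  blowUp-inDegree s h = begin
    N * degIn G S s
      ≡⟨ weightedDeg-χ G N S s ⟨
    weightedDeg G (λ u → N * χ S u) s
      ≡⟨ weightedDeg-cong G (∣blowUpFibre∣ G H h₀ D⊆S) s ⟨
    weightedDeg G (λ u → ∣ Q u ∣ + X * χ D u) s
      ≡⟨ weightedDeg-+ G (∣_∣ ∘ Q) (λ u → X * χ D u) s ⟩
    weightedDeg G (∣_∣ ∘ Q) s + weightedDeg G (λ u → X * χ D u) s
      ≡⟨ cong (_+_ (weightedDeg G (∣_∣ ∘ Q) s)) (weightedDeg-χ G X D s) ⟩
    weightedDeg G (∣_∣ ∘ Q) s + X * degIn G D s
      ≤⟨ +-monoˡ-≤ (X * degIn G D s) (m≤m+n _ (degIn H (Q s) h)) ⟩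
    weightedDeg G (∣_∣ ∘ Q) s + degIn H (Q s) h + X * degIn G D s
      ≡⟨ cong (_+ X * degIn G D s) (degIn-fibred G H loopless Q s h) ⟨
    degIn (lex G H) T (combine s h) + X * degIn G D s ∎
    where open ≤-Reasoning

  blowUp-outDegree : ∀ {s} h → s ∈ S →
                     degIn (lex G H) (∁ T) (combine s h) ≤ N * degIn G (∁ S) s + X * (degIn G D s + χ D s)
  blowUp-outDegree {s} h s∈S = begin
    degIn (lex G H) (∁ T) (combine s h)
      ≡⟨ cong (λ T′ → degIn (lex G H) T′ (combine s h)) (∁-fibred G H Q) ⟩
    degIn (lex G H) (fibred G H (∁ ∘ Q)) (combine s h)
      ≡⟨ degIn-fibred G H loopless (∁ ∘ Q) s h ⟩
    weightedDeg G (∣_∣ ∘ ∁ ∘ Q) s + degIn H (∁ (Q s)) h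
      ≤⟨ +-monoʳ-≤ (weightedDeg G (∣_∣ ∘ ∁ ∘ Q) s) (∣p∩q∣≤∣p∣ (∁ (Q s)) (Nbhd H h)) ⟩
    weightedDeg G (∣_∣ ∘ ∁ ∘ Q) s + ∣ ∁ (Q s) ∣
      ≡⟨ cong₂ _+_ (weightedDeg-cong G ∣∁Q∣ s) (∣∁Q∣ s) ⟩
    weightedDeg G (λ u → N * χ (∁ S) u + X * χ D u) s + (N * χ (∁ S) s + X * χ D s)
      ≡⟨ cong₂ _+_ (weightedDeg-+ G (λ u → N * χ (∁ S) u) (λ u → X * χ D u) s)
                   (cong (λ c → N * c + X * χ D s) (χ-∉ (x∈p⇒x∉∁p s∈S))) ⟩
    weightedDeg G (λ u → N * χ (∁ S) u) s + weightedDeg G (λ u → X * χ D u) s + (N * 0 + X * χ D s)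
      ≡⟨ cong₂ _+_ (cong₂ _+_ (weightedDeg-χ G N (∁ S) s) (weightedDeg-χ G X D s))
                   (cong (_+ X * χ D s) (*-zeroʳ N)) ⟩
    N * degIn G (∁ S) s + X * degIn G D s + X * χ D s
      ≡⟨ +-assoc (N * degIn G (∁ S) s) _ _ ⟩
    N * degIn G (∁ S) s + (X * degIn G D s + X * χ D s)
      ≡⟨ cong (_+_ (N * degIn G (∁ S) s)) (*-distribˡ-+ X (degIn G D s) (χ D s)) ⟨
    N * degIn G (∁ S) s + X * (degIn G D s + χ D s) ∎
    where
    open ≤-Reasoning
    ∣∁Q∣ : ∀ u → ∣ ∁ (Q u) ∣ ≡ N * χ (∁ S) u + X * χ D u
    ∣∁Q∣ = ∣∁blowUpFibre∣ G H h₀ D⊆S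

  blowUp-defends : ∀ {k m} → 1 ≤ k → m + m ≤ k → Independent G D → (∀ s → s ∈ S → degIn G D s ≤ m) →
                   (∀ v → v ∈ S → degIn G (∁ S) v + k ≤ degIn G S v) →
                   ∀ x → x ∈ T → degIn (lex G H) (∁ T) x + k ≤ degIn (lex G H) T x
  blowUp-defends {k} {m} 1≤k 2m≤k indep packing defends = combine-elim _ λ s h sh∈T →
    let s∈S = blowUp⇒∈ G H h₀ D⊆S sh∈T in
    scaled-defence {N} (defends s s∈S) (blowUp-outDegree h s∈S) (blowUp-inDegree s h)
      (scaled-budget h₀ (surplus s∈S))
    where
    surplus : ∀ {s} → s ∈ S → degIn G D s + χ D s + degIn G D s ≤ k
    surplus {s} s∈S with s ∈? D
    ... | yes s∈D rewrite Independent⇒degIn≡0 G indep s∈D | χ-∈ s∈D = 1≤k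
    ... | no s∉D rewrite χ-∉ s∉D | +-identityʳ (degIn G D s) =
      ≤-trans (+-mono-≤ (packing s s∈S) (packing s s∈S)) 2m≤k

  blowUp-dominating : Independent G D → Dominating G S →
                      (∀ v → v ∈ S → ∃ λ u → u ∈ S × adj G v u ≡ true) → Dominating (lex G H) T
  blowUp-dominating indep dom noIsolated = combine-elim _ dominated
    where
    dominated : ∀ u h → combine u h ∉ T → ∃ λ y → y ∈ T × adj (lex G H) (combine u h) y ≡ true
    dominated u h uh∉T with u ∈? S | u ∈? D
    ... | no u∉S | _ with dom u u∉S
    ...   | s , s∈S , us = combine s h₀ , h₀∈blowUp G H h₀ s∈S , adj-lex-lift G H h h₀ us
    dominated u h uh∉T | yes u∈S | no u∉D = contradiction (∈blowUp-full G H h₀ h u∈S u∉D) uh∉T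
    dominated u h uh∉T | yes u∈S | yes u∈D with noIsolated u u∈S
    ... | v , v∈S , uv = combine v h , ∈blowUp-full G H h₀ h v∈S v∉D , adj-lex-lift G H h h uv
      where
      v∉D : v ∉ D
      v∉D v∈D = contradiction (trans (sym uv) (indep u∈D v∈D)) λ ()

  blowUp-isGDA : ∀ {k m} → 1 ≤ k → m + m ≤ k → Independent G D → (∀ s → s ∈ S → degIn G D s ≤ m) →
                 IsGDA G (+ k) S → IsGDA (lex G H) (+ k) T
  blowUp-isGDA {k} 1≤k 2m≤k indep packing ((s₀ , s₀∈S) , dom , alliance) =
    (combine s₀ h₀ , h₀∈blowUp G H h₀ s₀∈S) ,
    blowUp-dominating indep dom noIsolated ,
    λ x x∈T → ℤ.+≤+ (blowUp-defends 1≤k 2m≤k indep packing defends x x∈T)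
    where
    defends : ∀ v → v ∈ S → degIn G (∁ S) v + k ≤ degIn G S v
    defends v v∈S = drop‿+≤+ (alliance v v∈S)
    noIsolated : ∀ v → v ∈ S → ∃ λ u → u ∈ S × adj G v u ≡ true
    noIsolated v v∈S = degIn>0⇒neighbour G S v (≤-trans 1≤k (≤-trans (m≤n+m k _) (defends v v∈S)))

theorem3p1 : (G H : Graph) → IsSimple G → IsSimple H
    → (k : ℤ) → + 0 ℤ.< k
    → (S : Subset (n G)) → IsMinGDA G k S
    → (∃ λ D → IsPerfectCodeInduced G S D)
    → 1 < n H
    → (∃ λ T → IsGDA (lex G H) k T)
      × (+ 2 ℤ.≤ k → (g : ℕ) → IsDomNumInduced G S g
          → ∃ λ T → IsGDA (lex G H) k T × ∣ T ∣ ≤ n H * (∣ S ∣ ∸ g) + g)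
theorem3p1 _ _ _ _ (+ zero) (ℤ.+<+ ()) _ _ _ _
theorem3p1 G H (_ , loopless) _ (+ suc k) _ S (S-gda , _) (D , code) 1<nH =
  (blowUp G H S ⊥ h₀ ,
   blowUp-isGDA G H loopless h₀ ⊥⊆ (s≤s z≤n) z≤n (⊥-independent G) (λ s _ → degIn-⊥ G s) S-gda) ,
  λ { (ℤ.+≤+ 2≤k) g (_ , g-minimal) →
        blowUp G H S D h₀ ,
        blowUp-isGDA G H loopless h₀ (proj₁ code) (s≤s z≤n) 2≤k
          (perfectCode-independent G code loopless) (perfectCode-packing G code) S-gda ,
        blowUp-size G H h₀ (proj₁ code) (g-minimal D (perfectCode-dominating G code)) }
  where
  h₀ : Fin (n H)
  h₀ = fromℕ< (<-trans (s≤s z≤n) 1<nH)
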